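{- Let $h,\ell$ be integers with $\ell\ge 3$ and $h\ge 2$, and let $n$ be a positive integer. Suppose $D=\{g_1,\dots,g_h\}\subseteq\mathbb{Z}_n$ has the property that the $h\ell$ values $|jg_i|_n$, for $i\in\{1,\dots,h\}$ and $j\in\{1,\dots,\ell\}$, are pairwise distinct. For each $i$, let $\mathcal{F}_i$ be the family consisting of $i$ copies of $\mathrm{AP}_n(g_i,\ell)$ together with $h-i$ copies of $\mathrm{AP}_n(g_i,\ell+1)$. Then $\mathcal{F}=\bigcup_{i=1}^h\mathcal{F}_i$ (union of families, counting copies) is an Erdős-deep family of $s=h^2$ sets whose distance multiset $\Delta\mathcal{F}$ has $\binom{k}{2}$ elements, where $k=h\ell$.
   Context: For $x\in\mathbb{Z}_n$, $|x|_n:=\min(x,-x)$ with $\pm x$ reduced into $\{0,\dots,n-1\}$, and $\mathrm{dist}(x,y)=|x-y|_n$. For $A\subseteq\mathbb{Z}_n$, $\Delta A$ is the multiset of $\mathrm{dist}(x,y)$ over unordered pairs $\{x,y\}\subseteq A$ with $x\neq y$; for a family $\mathcal{F}$ of subsets (repetitions allowed), $\Delta\mathcal{F}$ is the multiset union of $\Delta A$ over the members $A$ of $\mathcal{F}$, counted with repetition. $\mathcal{F}$ is Erdős-deep if the multiplicities of the distinct values in $\Delta\mathcal{F}$ are exactly $1,2,\dots,k-1$ for some integer $k$. $\mathrm{AP}_n(g,m):=\{0,g,2g,\dots,(m-1)g\}\subseteq\mathbb{Z}_n$. -}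

module Defs where

open import Data.Bool using (Bool; true; false; _∧_; if_then_else_)
open import Data.Nat using (ℕ; zero; suc; _+_; _*_; _∸_; _⊓_; _<ᵇ_; NonZero)
open import Data.Nat.Properties using (_≟_)
open import Data.Nat.DivMod using (_%_)
open import Data.Fin using (Fin; toℕ)
open import Data.Fin.Subset using (Subset)
open import Data.Vec using (tabulate; lookup)
open import Data.List using (List; []; _∷_; _++_; length; filter; map; concatMap; applyUpTo; upTo; allFin; replicate; deduplicate)
open import Data.Bool.ListAction using (any)
open import Data.List.Relation.Binary.Permutation.Propositional using (_↭_)
open import Data.Product using (∃)
open import Relation.Nullary.Decidable using (⌊_⌋)

absn : (n : ℕ) → .{{_ : NonZero n}} → ℕ → ℕ
absn n x = (x % n) ⊓ ((n ∸ (x % n)) % n)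

distn : (n : ℕ) → .{{_ : NonZero n}} → ℕ → ℕ → ℕ
distn n x y = absn n (x + (n ∸ (y % n)))

-- AP_n(g,m) = {0, g, 2g, ..., (m-1)g} as a subset of Z_n
AP : (n : ℕ) → .{{_ : NonZero n}} → ℕ → ℕ → Subset n
AP n g m = tabulate (λ x → any (λ j → ⌊ ((j * g) % n) ≟ toℕ x ⌋) (upTo m))

ΔS : (n : ℕ) → .{{_ : NonZero n}} → Subset n → List ℕ
ΔS n A = concatMap (λ x → concatMap (λ y →
           if (toℕ x <ᵇ toℕ y) ∧ lookup A x ∧ lookup A y
           then distn n (toℕ x) (toℕ y) ∷ [] else []) (allFin n)) (allFin n)

ΔF : (n : ℕ) → .{{_ : NonZero n}} → List (Subset n) → List ℕ
ΔF n F = concatMap (ΔS n) F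

mult : ℕ → List ℕ → ℕ
mult d L = length (filter (d ≟_) L)

ErdosDeep : List ℕ → Set
ErdosDeep L = ∃ λ k → map (λ d → mult d L) (deduplicate _≟_ L) ↭ applyUpTo suc (k ∸ 1)

family : (n : ℕ) → .{{_ : NonZero n}} → (h ℓ : ℕ) → (Fin h → Fin n) → List (Subset n)
family n h ℓ g = concatMap (λ i →
    replicate (suc (toℕ i)) (AP n (toℕ (g i)) ℓ)
    ++ replicate (h ∸ suc (toℕ i)) (AP n (toℕ (g i)) (suc ℓ))) (allFin h)

-- In AP_n(g, m) with distinct points jg (0 ≤ j < m), the pair {ag, bg} has distance |(b - a) g|_n,
-- so |c g|_n occurs m - c times in its distance multiset.  The hypothesis (with ℓ ≥ 3, which rules
-- out c g ≡ 0) makes the ℓ + 1 points of each progression distinct and the values |c g_i|_n pairwise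
-- distinct, so |c g_i|_n occurs (i + 1)(ℓ - c) + (h - 1 - i)(ℓ + 1 - c) = (h - 1 - i) + (ℓ - c) h
-- times in ΔF (i counted from 0).  Read in base h, these numbers run through 0, …, hℓ - 1 exactly
-- once; the nonzero ones are the multiplicities 1, …, k - 1, whose sum k(k - 1)/2 is the size of ΔF.

module Submission where

open import Defs
open import Data.Nat.Properties
open import Algebra.Properties.CommutativeSemigroup using (interchange)
open import Data.Bool using (Bool; true; false; T; _∧_; if_then_else_)
open import Data.Bool.Properties using (T-≡)
open import Data.Fin using (Fin; toℕ; opposite)
open import Data.Fin.Properties using (toℕ-injective; toℕ-fromℕ<; toℕ<n; opposite-prop; opposite-involutive)
open import Data.Fin.Subset using (Subset)
open import Data.List
  using (List; []; _∷_; _++_; map; concat; concatMap; replicate; deduplicate; filter; filterᵇ; length;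
         applyUpTo; upTo; allFin)
open import Data.List.Properties
  using (++-assoc; length-++; length-replicate; length-tabulate; map-++; map-cong; map-cong-local;
         concatMap-++; applyUpTo-∷ʳ; map-applyUpTo; map-upTo; filter-++; filter-none; filter-accept; filter-reject)
open import Data.List.Membership.Propositional using (_∈_; _∉_)
open import Data.List.Membership.Propositional.Properties
  using (∈-map⁺; ∈-map⁻; ∈-++⁻; ∈-applyUpTo⁺; ∈-applyUpTo⁻; ∈-filter⁺; ∈-filter⁻; ∈-allFin; ∈-length;
         ∈-deduplicate⁺; ∈-deduplicate⁻)
open import Data.List.Membership.Propositional.Properties.WithK using (unique∧set⇒bag)
open import Data.List.Membership.DecPropositional _≟_ using (_∈?_)
open import Data.List.Relation.Binary.BagAndSetEquality using (∼bag⇒↭)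
open import Data.List.Relation.Binary.Permutation.Propositional
  using (_↭_; ↭-refl; ↭-trans; prep; module PermutationReasoning)
import Data.List.Relation.Binary.Permutation.Propositional as ↭
open import Data.List.Relation.Binary.Permutation.Propositional.Properties
  using (map⁺; ++⁺; ++⁺ʳ; ++-comm; filter-↭; ↭-length; ∈-resp-↭)
open import Data.List.Relation.Unary.All using (All; []; _∷_)
import Data.List.Relation.Unary.All as All
import Data.List.Relation.Unary.All.Properties as All
open import Data.List.Relation.Unary.All.Properties using (¬Any⇒All¬; All¬⇒¬Any)
open import Data.List.Relation.Unary.AllPairs using (AllPairs; []; _∷_)
open import Data.List.Relation.Unary.AllPairs.Properties using (tabulate⁺-<)
open import Data.List.Relation.Unary.Any using (here; there)
open import Data.List.Relation.Unary.Any.Properties using (any⁺; any⁻; applyUpTo⁺; applyUpTo⁻)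
open import Data.List.Relation.Unary.Unique.Propositional using (Unique)
open import Data.List.Relation.Unary.Unique.Propositional.Properties using (applyUpTo⁺₁; filter⁺; allFin⁺)
open import Data.List.Relation.Unary.Unique.DecPropositional.Properties _≟_ using (deduplicate-!)
open import Data.Nat
  using (ℕ; zero; suc; _+_; _*_; _∸_; _⊓_; _≤_; _<_; _<ᵇ_; _≤?_; _<?_; z≤n; s≤s; s≤s⁻¹; z<s; s<s;
         NonZero; >-nonZero; >-nonZero⁻¹)
open import Data.Nat.Combinatorics using (_C_; nC1≡n; nCk+nC[k+1]≡[n+1]C[k+1])
open import Data.Nat.DivMod
  using (_%_; _/_; _mod_; %-distribˡ-+; m%n%n≡m%n; m%n<n; m%n≤n; m<n⇒m%n≡m; n%n≡0; [m+kn]%n≡m%n;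
         m≡m%n+[m/n]*n; m<n*o⇒m/o<n)
open import Data.Nat.ListAction using (sum)
open import Data.Nat.ListAction.Properties using (sum-++; sum-↭)
open import Data.Nat.Tactic.RingSolver using (solve-∀)
open import Data.Product using (_×_; _,_; ∃; ∃₂; proj₁; proj₂)
open import Data.Sum using (inj₁; inj₂)
open import Data.Vec using (lookup)
open import Data.Vec.Properties using (lookup∘tabulate)
open import Function using (_∘_; id)
open import Function.Bundles using (Equivalence; mk⇔)
open import Relation.Binary.PropositionalEquality
open import Relation.Nullary using (¬_; yes; no; contradiction)
open import Relation.Nullary.Decidable using (⌊_⌋; T?; toWitness; fromWitness)

module Modular (n : ℕ) .{{_ : NonZero n}} where

  infix 4 _≈_
  _≈_ : ℕ → ℕ → Set
  x ≈ y = x % n ≡ y % n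

  neg : ℕ → ℕ
  neg x = n ∸ x % n

  %-≈ : ∀ x → x % n ≈ x
  %-≈ x = m%n%n≡m%n x n

  +-cong-≈ : ∀ {x x′ y y′} → x ≈ x′ → y ≈ y′ → x + y ≈ x′ + y′
  +-cong-≈ {x} {x′} {y} {y′} x≈x′ y≈y′ = begin
    (x + y) % n             ≡⟨ %-distribˡ-+ x y n ⟩
    (x % n + y % n) % n     ≡⟨ cong₂ (λ a b → (a + b) % n) x≈x′ y≈y′ ⟩
    (x′ % n + y′ % n) % n   ≡⟨ %-distribˡ-+ x′ y′ n ⟨
    (x′ + y′) % n           ∎
    where open ≡-Reasoning

  +-neg : ∀ x → x + neg x ≈ 0
  +-neg x = begin
    (x + neg x) % n       ≡⟨ +-cong-≈ (sym (%-≈ x)) refl ⟩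
    (x % n + neg x) % n   ≡⟨ cong (_% n) (m+[n∸m]≡n (m%n≤n x n)) ⟩
    n % n                 ≡⟨ n%n≡0 n ⟩
    0                     ≡⟨ m<n⇒m%n≡m (>-nonZero⁻¹ n) ⟨
    0 % n                 ∎
    where open ≡-Reasoning

  ≈-sub : ∀ {x y z} → x + y ≈ z → y ≈ z + neg x
  ≈-sub {x} {y} {z} x+y≈z = begin
    y % n                   ≡⟨ cong (_% n) (+-identityʳ y) ⟨
    (y + 0) % n             ≡⟨ +-cong-≈ {y} refl (sym (+-neg x)) ⟩
    (y + (x + neg x)) % n   ≡⟨ cong (_% n) (regroup y x (neg x)) ⟩
    ((x + y) + neg x) % n   ≡⟨ +-cong-≈ x+y≈z refl ⟩
    (z + neg x) % n         ∎
    where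
    open ≡-Reasoning
    regroup : ∀ a b c → a + (b + c) ≡ (b + a) + c
    regroup = solve-∀

  absn-cong : ∀ {x y} → x ≈ y → absn n x ≡ absn n y
  absn-cong x≈y = cong (λ r → r ⊓ ((n ∸ r) % n)) x≈y

  absn-neg : ∀ x → absn n (neg x) ≡ absn n x
  absn-neg x = swap (x % n) (m%n<n x n)
    where
    swap : ∀ r → r < n → (n ∸ r) % n ⊓ ((n ∸ (n ∸ r) % n) % n) ≡ r ⊓ ((n ∸ r) % n)
    swap zero _ = cong (_⊓ ((n ∸ n % n) % n)) (n%n≡0 n)
    swap (suc r) r<n
      rewrite m<n⇒m%n≡m (∸-monoʳ-< {n} {suc r} {0} z<s (<⇒≤ r<n))
            | m∸[m∸n]≡n (<⇒≤ r<n) | m<n⇒m%n≡m r<n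
      = ⊓-comm (n ∸ suc r) (suc r)

  absn-resp-neg : ∀ {x y} → x + y ≈ 0 → absn n x ≡ absn n y
  absn-resp-neg {x} {y} x+y≈0 = trans (sym (absn-neg x)) (absn-cong (sym (≈-sub x+y≈0)))

  ≈-cancelˡ : ∀ {x y} → x + y ≈ x → y ≈ 0
  ≈-cancelˡ {x} x+y≈x = trans (≈-sub x+y≈x) (+-neg x)

  distn-comm : ∀ x y → distn n x y ≡ distn n y x
  distn-comm x y = absn-resp-neg (begin
    (x + neg y + (y + neg x)) % n     ≡⟨ cong (_% n) (regroup x (neg y) y (neg x)) ⟩
    ((x + neg x) + (y + neg y)) % n   ≡⟨ +-cong-≈ (+-neg x) (+-neg y) ⟩
    0 % n                             ∎)
    where
    open ≡-Reasoning
    regroup : ∀ a b c d → a + b + (c + d) ≡ (a + d) + (c + b)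
    regroup = solve-∀

  distn-multiples : ∀ G a c → distn n ((a * G) % n) (((a + c) * G) % n) ≡ absn n (c * G)
  distn-multiples G a c = absn-resp-neg (begin
    ((a * G) % n + neg b + c * G) % n     ≡⟨ cong (_% n) (regroup ((a * G) % n) (neg b) (c * G)) ⟩
    ((a * G) % n + c * G + neg b) % n     ≡⟨ +-cong-≈ {(a * G) % n + c * G} aG+cG≈b refl ⟩
    (b + neg b) % n                       ≡⟨ +-neg b ⟩
    0 % n                                 ∎)
    where
    open ≡-Reasoning
    b = ((a + c) * G) % n
    regroup : ∀ x y z → x + y + z ≡ x + z + y
    regroup = solve-∀
    aG+cG≈b : (a * G) % n + c * G ≈ b
    aG+cG≈b = begin
      ((a * G) % n + c * G) % n   ≡⟨ +-cong-≈ (%-≈ (a * G)) refl ⟩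
      (a * G + c * G) % n         ≡⟨ cong (_% n) (*-distribʳ-+ G a c) ⟨
      ((a + c) * G) % n           ≡⟨ %-≈ ((a + c) * G) ⟨
      b % n                       ∎

mult-++ : ∀ d xs ys → mult d (xs ++ ys) ≡ mult d xs + mult d ys
mult-++ d xs ys = trans (cong length (filter-++ (d ≟_) xs ys)) (length-++ (filter (d ≟_) xs))

mult-∉ : ∀ {d xs} → d ∉ xs → mult d xs ≡ 0
mult-∉ {d} {xs} d∉xs = cong length (filter-none (d ≟_) (¬Any⇒All¬ xs d∉xs))

mult-∷-≡ : ∀ {d y} ys → d ≡ y → mult d (y ∷ ys) ≡ suc (mult d ys)
mult-∷-≡ {d} ys d≡y = cong length (filter-accept (d ≟_) d≡y)

mult-∷-≢ : ∀ {d y} ys → d ≢ y → mult d (y ∷ ys) ≡ mult d ys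
mult-∷-≢ {d} ys d≢y = cong length (filter-reject (d ≟_) d≢y)

mult-unique-∈ : ∀ {x xs} → Unique xs → x ∈ xs → mult x xs ≡ 1
mult-unique-∈ {xs = _ ∷ ys} (x∉ys ∷ _) (here refl) =
  trans (mult-∷-≡ ys refl) (cong suc (mult-∉ (All¬⇒¬Any x∉ys)))
mult-unique-∈ {xs = _ ∷ ys} (y∉ys ∷ ys!) (there x∈ys) =
  trans (mult-∷-≢ ys (λ x≡y → All.lookup y∉ys x∈ys (sym x≡y))) (mult-unique-∈ ys! x∈ys)

mult-map-injectiveOn : ∀ (f : ℕ → ℕ) {x} xs → All (λ y → f y ≡ f x → y ≡ x) xs →
                       mult (f x) (map f xs) ≡ mult x xs
mult-map-injectiveOn f [] [] = refl
mult-map-injectiveOn f {x} (y ∷ ys) (inj ∷ injs) with x ≟ y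
... | yes x≡y = trans (mult-∷-≡ (map f ys) (cong f x≡y))
                      (trans (cong suc (mult-map-injectiveOn f ys injs)) (sym (mult-∷-≡ ys x≡y)))
... | no x≢y  = trans (mult-∷-≢ (map f ys) (λ fx≡fy → x≢y (sym (inj (sym fx≡fy)))))
                      (trans (mult-map-injectiveOn f ys injs) (sym (mult-∷-≢ ys x≢y)))

mult-↭ : ∀ {d xs ys} → xs ↭ ys → mult d xs ≡ mult d ys
mult-↭ {d} xs↭ys = ↭-length (filter-↭ (d ≟_) xs↭ys)

mult-∈ : ∀ {x xs} → x ∈ xs → 1 ≤ mult x xs
mult-∈ {x} x∈xs = ∈-length (∈-filter⁺ (x ≟_) x∈xs refl)

mult-pos⇒∈ : ∀ {x xs} → 1 ≤ mult x xs → x ∈ xs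
mult-pos⇒∈ {x} {xs} 1≤mult with x ∈? xs
... | yes x∈xs = x∈xs
... | no  x∉xs = contradiction (subst (1 ≤_) (mult-∉ x∉xs) 1≤mult) λ ()

mult-concatMap : ∀ {A : Set} d (f : A → List ℕ) xs → mult d (concatMap f xs) ≡ sum (map (mult d ∘ f) xs)
mult-concatMap d f []       = refl
mult-concatMap d f (x ∷ xs) =
  trans (mult-++ d (f x) (concatMap f xs)) (cong (mult d (f x) +_) (mult-concatMap d f xs))

mult-concatMap-replicate : ∀ {A : Set} d (f : A → List ℕ) a x →
                           mult d (concatMap f (replicate a x)) ≡ a * mult d (f x)
mult-concatMap-replicate d f zero    x = refl
mult-concatMap-replicate d f (suc a) x =
  trans (mult-++ d (f x) _) (cong (mult d (f x) +_) (mult-concatMap-replicate d f a x))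

sum-map-[x] : ∀ x ds → sum (map (λ d → mult d (x ∷ [])) ds) ≡ mult x ds
sum-map-[x] x []       = refl
sum-map-[x] x (d ∷ ds) with x ≟ d
... | yes x≡d = trans (cong₂ _+_ (mult-∷-≡ [] (sym x≡d)) (sum-map-[x] x ds)) (sym (mult-∷-≡ ds x≡d))
... | no  x≢d = trans (cong₂ _+_ (mult-∷-≢ [] (x≢d ∘ sym)) (sum-map-[x] x ds)) (sym (mult-∷-≢ ds x≢d))

sum-map-+ : ∀ {A : Set} (f g : A → ℕ) xs → sum (map (λ x → f x + g x) xs) ≡ sum (map f xs) + sum (map g xs)
sum-map-+ f g []       = refl
sum-map-+ f g (x ∷ xs) = trans (cong (f x + g x +_) (sum-map-+ f g xs)) (interchange +-commutativeSemigroup (f x) (g x) _ _)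

sum-map-zero : ∀ {A : Set} {f : A → ℕ} {xs} → All (λ x → f x ≡ 0) xs → sum (map f xs) ≡ 0
sum-map-zero []             = refl
sum-map-zero (fx≡0 ∷ fxs≡0) = cong₂ _+_ fx≡0 (sum-map-zero fxs≡0)

sum-map-onlyAt : ∀ {A : Set} (f : A → ℕ) {x xs} → Unique xs → x ∈ xs → (∀ {y} → y ≢ x → f y ≡ 0) →
                 sum (map f xs) ≡ f x
sum-map-onlyAt f {x} (x∉ys ∷ _) (here refl) f≡0 =
  trans (cong (f x +_) (sum-map-zero (All.map (f≡0 ∘ ≢-sym) x∉ys))) (+-identityʳ (f x))
sum-map-onlyAt f (y∉ys ∷ ys!) (there x∈ys) f≡0 =
  cong₂ _+_ (f≡0 (All.lookup y∉ys x∈ys)) (sum-map-onlyAt f ys! x∈ys f≡0)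

concatMap-concatMap : ∀ {A B C : Set} (f : B → List C) (g : A → List B) xs →
                      concatMap f (concatMap g xs) ≡ concatMap (concatMap f ∘ g) xs
concatMap-concatMap f g []       = refl
concatMap-concatMap f g (x ∷ xs) =
  trans (concatMap-++ f (g x) (concatMap g xs)) (cong (concatMap f (g x) ++_) (concatMap-concatMap f g xs))

length-concatMap-const : ∀ {A B : Set} {f : A → List B} {c} → (∀ x → length (f x) ≡ c) →
                         ∀ xs → length (concatMap f xs) ≡ length xs * c
length-concatMap-const f≡c []       = refl
length-concatMap-const {f = f} f≡c (x ∷ xs) =
  trans (length-++ (f x)) (cong₂ _+_ (f≡c x) (length-concatMap-const f≡c xs))

unique-map-injectiveOn : ∀ {A B : Set} (f : A → B) {xs} →
                         (∀ {x y} → x ∈ xs → y ∈ xs → f x ≡ f y → x ≡ y) → Unique xs → Unique (map f xs)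
unique-map-injectiveOn f inj []            = []
unique-map-injectiveOn f inj (x∉xs ∷ xs!) =
  All.map⁺ (All.tabulate (λ y∈xs fx≡fy → All.lookup x∉xs y∈xs (inj (here refl) (there y∈xs) fx≡fy)))
  ∷ unique-map-injectiveOn f (λ x∈ y∈ → inj (there x∈) (there y∈)) xs!

sum-mult-cover : ∀ {ds} xs → Unique ds → (∀ {x} → x ∈ xs → x ∈ ds) →
                 sum (map (λ d → mult d xs) ds) ≡ length xs
sum-mult-cover {ds} [] _ _ = sum-map-zero {f = λ d → mult d []} {ds} (All.tabulate (λ _ → refl))
sum-mult-cover {ds} (x ∷ xs) ds! xs⊆ds = begin
  sum (map (λ d → mult d (x ∷ xs)) ds)
    ≡⟨ cong sum (map-cong (λ d → mult-++ d (x ∷ []) xs) ds) ⟩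
  sum (map (λ d → mult d (x ∷ []) + mult d xs) ds)
    ≡⟨ sum-map-+ (λ d → mult d (x ∷ [])) (λ d → mult d xs) ds ⟩
  sum (map (λ d → mult d (x ∷ [])) ds) + sum (map (λ d → mult d xs) ds)
    ≡⟨ cong₂ _+_ (trans (sum-map-[x] x ds) (mult-unique-∈ ds! (xs⊆ds (here refl))))
                 (sum-mult-cover xs ds! (xs⊆ds ∘ there)) ⟩
  suc (length xs)
    ∎
  where open ≡-Reasoning

sum-mult-deduplicate : ∀ xs → sum (map (λ d → mult d xs) (deduplicate _≟_ xs)) ≡ length xs
sum-mult-deduplicate xs = sum-mult-cover xs (deduplicate-! xs) (∈-deduplicate⁺ _≟_)

sum-applyUpTo-suc : ∀ m → sum (applyUpTo suc m) ≡ suc m C 2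
sum-applyUpTo-suc zero    = refl
sum-applyUpTo-suc (suc m) = begin
  sum (applyUpTo suc (suc m))           ≡⟨ cong sum (applyUpTo-∷ʳ suc m) ⟨
  sum (applyUpTo suc m ++ suc m ∷ [])   ≡⟨ sum-++ (applyUpTo suc m) (suc m ∷ []) ⟩
  sum (applyUpTo suc m) + (suc m + 0)   ≡⟨ cong₂ _+_ (sum-applyUpTo-suc m) (trans (+-identityʳ (suc m)) (sym (nC1≡n (suc m)))) ⟩
  suc m C 2 + suc m C 1                 ≡⟨ +-comm (suc m C 2) (suc m C 1) ⟩
  suc m C 1 + suc m C 2                 ≡⟨ nCk+nC[k+1]≡[n+1]C[k+1] (suc m) 1 ⟩
  suc (suc m) C 2                       ∎
  where open ≡-Reasoning

length-deep : ∀ k xs → map (λ d → mult d xs) (deduplicate _≟_ xs) ↭ applyUpTo suc (k ∸ 1) →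
              length xs ≡ k C 2
length-deep k xs mults↭ = trans (sym (sum-mult-deduplicate xs)) (trans (sum-↭ mults↭) (sum-upTo-pred k))
  where
  sum-upTo-pred : ∀ k → sum (applyUpTo suc (k ∸ 1)) ≡ k C 2
  sum-upTo-pred zero    = refl
  sum-upTo-pred (suc m) = sum-applyUpTo-suc m

unique-applyUpTo-suc : ∀ m → Unique (applyUpTo suc m)
unique-applyUpTo-suc m = applyUpTo⁺₁ suc m (λ i<j _ → <⇒≢ (s<s i<j))

∈-applyUpTo-suc⁺ : ∀ {t} k → 1 ≤ t → t < k → t ∈ applyUpTo suc (k ∸ 1)
∈-applyUpTo-suc⁺ (suc k) (s≤s z≤n) (s≤s t<1+k) = ∈-applyUpTo⁺ suc t<1+k

∈-applyUpTo-suc⁻ : ∀ {t} k → t ∈ applyUpTo suc (k ∸ 1) → 1 ≤ t × t < k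
∈-applyUpTo-suc⁻ (suc k) t∈ with _ , t′<k , refl ← ∈-applyUpTo⁻ suc t∈ = s≤s z≤n , s<s t′<k

gaps : ℕ → List ℕ
gaps zero    = []
gaps (suc m) = applyUpTo suc m ++ gaps m

∈-gaps⁻ : ∀ {c} m → c ∈ gaps m → 1 ≤ c × c < m
∈-gaps⁻ (suc m) c∈gaps with ∈-++⁻ (applyUpTo suc m) c∈gaps
... | inj₁ c∈row with _ , i<m , refl ← ∈-applyUpTo⁻ suc c∈row = s≤s z≤n , s<s i<m
... | inj₂ c∈gaps′ with 1≤c , c<m ← ∈-gaps⁻ m c∈gaps′ = 1≤c , m<n⇒m<1+n c<m

mult-gaps : ∀ {c} m → 1 ≤ c → mult c (gaps m) ≡ m ∸ c
mult-gaps {c} zero    _   = sym (0∸n≡0 c)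
mult-gaps {c} (suc m) 1≤c = begin
  mult c (applyUpTo suc m ++ gaps m)           ≡⟨ mult-++ c (applyUpTo suc m) (gaps m) ⟩
  mult c (applyUpTo suc m) + mult c (gaps m)   ≡⟨ cong (mult c (applyUpTo suc m) +_) (mult-gaps m 1≤c) ⟩
  mult c (applyUpTo suc m) + (m ∸ c)           ≡⟨ row 1≤c ⟩
  suc m ∸ c                                    ∎
  where
  open ≡-Reasoning
  row : 1 ≤ c → mult c (applyUpTo suc m) + (m ∸ c) ≡ suc m ∸ c
  row (s≤s z≤n) with c ≤? m
  ... | yes c≤m = begin
        mult c (applyUpTo suc m) + (m ∸ c) ≡⟨ cong (_+ (m ∸ c)) (mult-unique-∈ (unique-applyUpTo-suc m) (∈-applyUpTo⁺ suc c≤m)) ⟩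
        1 + (m ∸ c)                         ≡⟨ +-∸-assoc 1 c≤m ⟨
        suc m ∸ c                           ∎
  ... | no c≰m = begin
        mult c (applyUpTo suc m) + (m ∸ c) ≡⟨ cong₂ _+_ (mult-∉ c∉row) (m≤n⇒m∸n≡0 (<⇒≤ m<c)) ⟩
        0                                   ≡⟨ m≤n⇒m∸n≡0 m<c ⟨
        suc m ∸ c                           ∎
    where
    m<c = ≰⇒> c≰m
    c∉row : c ∉ applyUpTo suc m
    c∉row c∈row with _ , i<m , refl ← ∈-applyUpTo⁻ suc c∈row = c≰m i<m

pairsWith : {A B : Set} → (A → A → B) → List A → List B
pairsWith f []       = []
pairsWith f (x ∷ xs) = map (f x) xs ++ pairsWith f xs

pairsWith-↭ : ∀ {A B : Set} {f : A → A → B} → (∀ x y → f x y ≡ f y x) →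
              ∀ {xs ys} → xs ↭ ys → pairsWith f xs ↭ pairsWith f ys
pairsWith-↭ f-comm ↭.refl = ↭-refl
pairsWith-↭ {f = f} f-comm (prep x xs↭ys) = ++⁺ (map⁺ (f x) xs↭ys) (pairsWith-↭ f-comm xs↭ys)
pairsWith-↭ f-comm (↭.trans xs↭ys ys↭zs) = ↭-trans (pairsWith-↭ f-comm xs↭ys) (pairsWith-↭ f-comm ys↭zs)
pairsWith-↭ {f = f} f-comm (↭.swap {xs} {ys} x y xs↭ys) rewrite f-comm y x = prep (f x y) (begin
  map (f x) xs ++ (map (f y) xs ++ pairsWith f xs)   ≡⟨ ++-assoc (map (f x) xs) _ _ ⟨
  (map (f x) xs ++ map (f y) xs) ++ pairsWith f xs   ↭⟨ ++⁺ʳ (pairsWith f xs) (++-comm (map (f x) xs) _) ⟩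
  (map (f y) xs ++ map (f x) xs) ++ pairsWith f xs   ≡⟨ ++-assoc (map (f y) xs) _ _ ⟩
  map (f y) xs ++ (map (f x) xs ++ pairsWith f xs)   ↭⟨ ++⁺ (map⁺ (f y) xs↭ys) (++⁺ (map⁺ (f x) xs↭ys) (pairsWith-↭ f-comm xs↭ys)) ⟩
  map (f y) ys ++ (map (f x) ys ++ pairsWith f ys)   ∎)
  where open PermutationReasoning

pairsWith-applyUpTo : ∀ {A B : Set} (f : A → A → B) (g : ℕ → A) (V : ℕ → B) →
                      (∀ {a b} → a < b → f (g a) (g b) ≡ V (b ∸ a)) →
                      ∀ m → pairsWith f (applyUpTo g m) ≡ map V (gaps m)
pairsWith-applyUpTo f g V f≡V zero    = refl
pairsWith-applyUpTo f g V f≡V (suc m) =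
  trans (cong₂ _++_ row (pairsWith-applyUpTo f (g ∘ suc) V (f≡V ∘ s<s) m))
        (sym (map-++ V (applyUpTo suc m) (gaps m)))
  where
  open ≡-Reasoning
  row : map (f (g 0)) (applyUpTo (g ∘ suc) m) ≡ map V (applyUpTo suc m)
  row = begin
    map (f (g 0)) (applyUpTo (g ∘ suc) m)      ≡⟨ map-applyUpTo (g ∘ suc) (f (g 0)) m ⟩
    applyUpTo (λ b → f (g 0) (g (suc b))) m    ≡⟨ map-upTo _ m ⟨
    map (λ b → f (g 0) (g (suc b))) (upTo m)   ≡⟨ map-cong (λ _ → f≡V z<s) (upTo m) ⟩
    map (V ∘ suc) (upTo m)                     ≡⟨ map-upTo (V ∘ suc) m ⟩
    applyUpTo (V ∘ suc) m                      ≡⟨ map-applyUpTo suc V m ⟨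
    map V (applyUpTo suc m)                    ∎

<ᵇ-≥ : ∀ {m n} → n ≤ m → (m <ᵇ n) ≡ false
<ᵇ-≥ {m} {n} n≤m with m <ᵇ n in m<ᵇn
... | false = refl
... | true  = contradiction (<ᵇ⇒< m n (subst T (sym m<ᵇn) _)) (≤⇒≯ n≤m)

module _ {A B : Set} (key : A → ℕ) (P : A → Bool) (f : A → A → B) where

  pairIf : A → A → List B
  pairIf x y = if (key x <ᵇ key y) ∧ P x ∧ P y then f x y ∷ [] else []

  concatMap-pairIf-later : ∀ x ys → All (λ y → key x < key y) ys →
                           concatMap (pairIf x) ys ≡ (if P x then map (f x) (filterᵇ P ys) else [])
  concatMap-pairIf-later x [] [] with P x
  ... | true  = refl
  ... | false = refl
  concatMap-pairIf-later x (y ∷ ys) (x<y ∷ x<ys)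
    rewrite Equivalence.to T-≡ (<⇒<ᵇ x<y) | concatMap-pairIf-later x ys x<ys with P x | P y
  ... | false | _     = refl
  ... | true  | true  = refl
  ... | true  | false = refl

  pairIf-earlier : ∀ {x y} → key y ≤ key x → pairIf x y ≡ []
  pairIf-earlier y≤x rewrite <ᵇ-≥ y≤x = refl

  concatMap-pairIf : ∀ xs → AllPairs (λ x y → key x < key y) xs →
                     concatMap (λ x → concatMap (pairIf x) xs) xs ≡ pairsWith f (filterᵇ P xs)
  concatMap-pairIf []       []                 = refl
  concatMap-pairIf (z ∷ xs) (z<xs ∷ xs-sorted) =
    trans (cong₂ _++_ first rest) cons
    where
    first : concatMap (pairIf z) (z ∷ xs) ≡ (if P z then map (f z) (filterᵇ P xs) else [])
    first = trans (cong (_++ concatMap (pairIf z) xs) (pairIf-earlier ≤-refl))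
                  (concatMap-pairIf-later z xs z<xs)
    rest : concatMap (λ x → concatMap (pairIf x) (z ∷ xs)) xs ≡ pairsWith f (filterᵇ P xs)
    rest = trans (cong concat (map-cong-local (All.map (λ z<x → cong (_++ _) (pairIf-earlier (<⇒≤ z<x))) z<xs)))
                 (concatMap-pairIf xs xs-sorted)
    cons : (if P z then map (f z) (filterᵇ P xs) else []) ++ pairsWith f (filterᵇ P xs)
           ≡ pairsWith f (filterᵇ P (z ∷ xs))
    cons with P z
    ... | true  = refl
    ... | false = refl

members : (n : ℕ) → Subset n → List (Fin n)
members n A = filterᵇ (lookup A) (allFin n)

ΔS-pairsWith : ∀ n .{{_ : NonZero n}} A →
               ΔS n A ≡ pairsWith (λ x y → distn n (toℕ x) (toℕ y)) (members n A)
ΔS-pairsWith n A =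
  concatMap-pairIf toℕ (lookup A) (λ x y → distn n (toℕ x) (toℕ y)) (allFin n) (tabulate⁺-< (λ i<j → i<j))

module Progression (n : ℕ) .{{_ : NonZero n}} (G : ℕ) where
  open Modular n

  point : ℕ → Fin n
  point j = (j * G) mod n

  toℕ-point : ∀ j → toℕ (point j) ≡ (j * G) % n
  toℕ-point j = toℕ-fromℕ< (m%n<n (j * G) n)

  private
    inAP : Fin n → ℕ → Bool
    inAP x j = ⌊ (j * G) % n ≟ toℕ x ⌋

  members-AP⊆ : ∀ {m x} → x ∈ members n (AP n G m) → x ∈ applyUpTo point m
  members-AP⊆ {m} {x} x∈AP
    with _ , x∈AP′ ← ∈-filter⁻ (T? ∘ lookup (AP n G m)) {xs = allFin n} x∈AP
    with j , j<m , jG≡x ← applyUpTo⁻ id (any⁻ (inAP x) (upTo m) (subst T (lookup∘tabulate _ x) x∈AP′))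
    = subst (_∈ applyUpTo point m) x≡point (∈-applyUpTo⁺ point j<m)
    where
    x≡point : point j ≡ x
    x≡point = toℕ-injective (trans (toℕ-point j) (toWitness jG≡x))

  members-AP⊇ : ∀ {m x} → x ∈ applyUpTo point m → x ∈ members n (AP n G m)
  members-AP⊇ {m} x∈points with j , j<m , refl ← ∈-applyUpTo⁻ point x∈points =
    ∈-filter⁺ (T? ∘ lookup (AP n G m)) (∈-allFin (point j))
      (subst T (sym (lookup∘tabulate _ (point j)))
        (any⁺ (inAP (point j)) (applyUpTo⁺ id (fromWitness (sym (toℕ-point j))) j<m)))

  V : ℕ → ℕ
  V c = absn n (c * G)

  distn-points : ∀ {a b} → a < b → distn n (toℕ (point a)) (toℕ (point b)) ≡ V (b ∸ a)
  distn-points {a} {b} a<b = begin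
    distn n (toℕ (point a)) (toℕ (point b))               ≡⟨ cong₂ (distn n) (toℕ-point a) (toℕ-point b) ⟩
    distn n ((a * G) % n) ((b * G) % n)                   ≡⟨ cong (λ x → distn n ((a * G) % n) ((x * G) % n)) (m+[n∸m]≡n (<⇒≤ a<b)) ⟨
    distn n ((a * G) % n) (((a + (b ∸ a)) * G) % n)       ≡⟨ distn-multiples G a (b ∸ a) ⟩
    V (b ∸ a)                                             ∎
    where open ≡-Reasoning

DistinctAbsMultiples : (n : ℕ) .{{_ : NonZero n}} → ℕ → ℕ → Set
DistinctAbsMultiples n ℓ G =
  ∀ c c′ → 1 ≤ c → c ≤ ℓ → 1 ≤ c′ → c′ ≤ ℓ → absn n (c * G) ≡ absn n (c′ * G) → c ≡ c′

module DistinctProgression (n : ℕ) .{{_ : NonZero n}} (G : ℕ) {ℓ} (3≤ℓ : 3 ≤ ℓ)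
                           (V-injective : DistinctAbsMultiples n ℓ G) where
  open Modular n
  open Progression n G

  private
    1≤ℓ : 1 ≤ ℓ
    1≤ℓ = ≤-trans (s≤s z≤n) 3≤ℓ

  -- If c G ≡ 0 then |(c + 1) G| = |G|, or, when c = ℓ, |(c - 1) G| = |G|; as ℓ ≥ 3 both contradict injectivity.
  multiple-≉0 : ∀ {c} → 1 ≤ c → c ≤ ℓ → ¬ (c * G ≈ 0)
  multiple-≉0 {suc k} _ c≤ℓ cG≈0 with suc k <? ℓ
  ... | yes c<ℓ =
    contradiction (V-injective (2 + k) 1 (s≤s z≤n) c<ℓ (s≤s z≤n) 1≤ℓ (absn-cong (+-cong-≈ {G} refl cG≈0))) λ ()
  ... | no c≮ℓ =
    <⇒≢ 1<k (sym (V-injective k 1 (<⇒≤ 1<k) (≤-trans (n≤1+n k) c≤ℓ) (s≤s z≤n) 1≤ℓ (absn-resp-neg kG+G≈0)))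
    where
    ℓ≡1+k = ≤-antisym (≮⇒≥ c≮ℓ) c≤ℓ
    1<k : 1 < k
    1<k = s≤s⁻¹ (subst (3 ≤_) ℓ≡1+k 3≤ℓ)
    kG+G≈0 : k * G + 1 * G ≈ 0
    kG+G≈0 = trans (cong (_% n) (regroup (k * G) G)) cG≈0
      where
      regroup : ∀ a b → a + (b + 0) ≡ b + a
      regroup = solve-∀

  points-distinct : ∀ {a b} → a < b → b ≤ ℓ → point a ≢ point b
  points-distinct {a} {b} a<b b≤ℓ pa≡pb =
    multiple-≉0 (m<n⇒0<n∸m a<b) (≤-trans (m∸n≤m b a) b≤ℓ) (≈-cancelˡ aG+cG≈aG)
    where
    open ≡-Reasoning
    aG+cG≈aG : a * G + (b ∸ a) * G ≈ a * G
    aG+cG≈aG = begin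
      (a * G + (b ∸ a) * G) % n   ≡⟨ cong (_% n) (*-distribʳ-+ G a (b ∸ a)) ⟨
      ((a + (b ∸ a)) * G) % n     ≡⟨ cong (λ x → (x * G) % n) (m+[n∸m]≡n (<⇒≤ a<b)) ⟩
      (b * G) % n                 ≡⟨ toℕ-point b ⟨
      toℕ (point b)               ≡⟨ cong toℕ pa≡pb ⟨
      toℕ (point a)               ≡⟨ toℕ-point a ⟩
      (a * G) % n                 ∎

  members-AP↭points : ∀ {m} → m ≤ suc ℓ → members n (AP n G m) ↭ applyUpTo point m
  members-AP↭points {m} m≤1+ℓ =
    ∼bag⇒↭ (unique∧set⇒bag (filter⁺ (T? ∘ lookup (AP n G m)) (allFin⁺ n)) points!
                           (mk⇔ members-AP⊆ members-AP⊇))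
    where
    points! : Unique (applyUpTo point m)
    points! = applyUpTo⁺₁ point m (λ i<j j<m → points-distinct i<j (s≤s⁻¹ (≤-trans j<m m≤1+ℓ)))

  ΔS-AP : ∀ {m} → m ≤ suc ℓ → ΔS n (AP n G m) ↭ map V (gaps m)
  ΔS-AP {m} m≤1+ℓ = begin
    ΔS n (AP n G m)                      ≡⟨ ΔS-pairsWith n (AP n G m) ⟩
    pairsWith dist (members n (AP n G m)) ↭⟨ pairsWith-↭ (λ x y → distn-comm (toℕ x) (toℕ y)) (members-AP↭points m≤1+ℓ) ⟩
    pairsWith dist (applyUpTo point m)    ≡⟨ pairsWith-applyUpTo dist point V distn-points m ⟩
    map V (gaps m)                       ∎
    where
    open PermutationReasoning
    dist : Fin n → Fin n → ℕ
    dist x y = distn n (toℕ x) (toℕ y)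

  mult-ΔS-AP : ∀ {c m} → 1 ≤ c → c ≤ ℓ → m ≤ suc ℓ → mult (V c) (ΔS n (AP n G m)) ≡ m ∸ c
  mult-ΔS-AP {c} {m} 1≤c c≤ℓ m≤1+ℓ = begin
    mult (V c) (ΔS n (AP n G m))   ≡⟨ mult-↭ (ΔS-AP m≤1+ℓ) ⟩
    mult (V c) (map V (gaps m))    ≡⟨ mult-map-injectiveOn V (gaps m) (All.tabulate V-injectiveOn) ⟩
    mult c (gaps m)                ≡⟨ mult-gaps m 1≤c ⟩
    m ∸ c                          ∎
    where
    open ≡-Reasoning
    V-injectiveOn : ∀ {c′} → c′ ∈ gaps m → V c′ ≡ V c → c′ ≡ c
    V-injectiveOn c′∈gaps with 1≤c′ , c′<m ← ∈-gaps⁻ m c′∈gaps =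
      V-injective _ c 1≤c′ (s≤s⁻¹ (≤-trans c′<m m≤1+ℓ)) 1≤c c≤ℓ

  ∈-ΔS-AP⁻ : ∀ {y m} → m ≤ suc ℓ → y ∈ ΔS n (AP n G m) → ∃ λ c → 1 ≤ c × c ≤ ℓ × y ≡ V c
  ∈-ΔS-AP⁻ {m = m} m≤1+ℓ y∈ΔS
    with c , c∈gaps , refl ← ∈-map⁻ V (∈-resp-↭ (ΔS-AP m≤1+ℓ) y∈ΔS)
    with 1≤c , c<m ← ∈-gaps⁻ m c∈gaps
    = c , 1≤c , s≤s⁻¹ (≤-trans c<m m≤1+ℓ) , refl

mixed-radix-injective : ∀ {h} .{{_ : NonZero h}} {r r′ u u′} → r < h → r′ < h →
                        r + u * h ≡ r′ + u′ * h → r ≡ r′ × u ≡ u′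
mixed-radix-injective {h} {r} {r′} {u} {u′} r<h r′<h eq = r≡r′ , u≡u′
  where
  open ≡-Reasoning
  r≡r′ : r ≡ r′
  r≡r′ = begin
    r                  ≡⟨ m<n⇒m%n≡m r<h ⟨
    r % h              ≡⟨ [m+kn]%n≡m%n r u h ⟨
    (r + u * h) % h    ≡⟨ cong (_% h) eq ⟩
    (r′ + u′ * h) % h  ≡⟨ [m+kn]%n≡m%n r′ u′ h ⟩
    r′ % h             ≡⟨ m<n⇒m%n≡m r′<h ⟩
    r′                 ∎
  u≡u′ : u ≡ u′
  u≡u′ = *-cancelʳ-≡ u u′ h (+-cancelˡ-≡ r (u * h) (u′ * h) (trans eq (cong (_+ u′ * h) (sym r≡r′))))

JointlyDistinctAbsMultiples : (n : ℕ) .{{_ : NonZero n}} (h ℓ : ℕ) → (Fin h → Fin n) → Set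
JointlyDistinctAbsMultiples n h ℓ g = ∀ (i i′ : Fin h) (j j′ : ℕ) → 1 ≤ j → j ≤ ℓ → 1 ≤ j′ → j′ ≤ ℓ →
  absn n (j * toℕ (g i)) ≡ absn n (j′ * toℕ (g i′)) → (i ≡ i′) × (j ≡ j′)

module Family (h ℓ n : ℕ) .{{_ : NonZero n}} (3≤ℓ : 3 ≤ ℓ) (2≤h : 2 ≤ h) (g : Fin h → Fin n)
              (distinct : JointlyDistinctAbsMultiples n h ℓ g) where

  instance
    h-nonZero : NonZero h
    h-nonZero = >-nonZero (≤-trans (s≤s z≤n) 2≤h)

  G : Fin h → ℕ
  G i = toℕ (g i)

  V : Fin h → ℕ → ℕ
  V i c = absn n (c * G i)

  V-injective : ∀ i → DistinctAbsMultiples n ℓ (G i)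
  V-injective i c c′ 1≤c c≤ℓ 1≤c′ c′≤ℓ eq = proj₂ (distinct i i c c′ 1≤c c≤ℓ 1≤c′ c′≤ℓ eq)

  module APᵢ (i : Fin h) = DistinctProgression n (G i) 3≤ℓ (V-injective i)

  copies : Fin h → List (Subset n)
  copies i = replicate (suc (toℕ i)) (AP n (G i) ℓ) ++ replicate (h ∸ suc (toℕ i)) (AP n (G i) (suc ℓ))

  ℱ : List (Subset n)
  ℱ = family n h ℓ g

  Δℱ : List ℕ
  Δℱ = ΔF n ℱ

  length-ℱ : length ℱ ≡ h * h
  length-ℱ = trans (length-concatMap-const length-copies (allFin h)) (cong (_* h) (length-tabulate {n = h} id))
    where
    length-copies : ∀ i → length (copies i) ≡ h
    length-copies i = begin
      length (copies i)               ≡⟨ length-++ (replicate (suc (toℕ i)) (AP n (G i) ℓ)) ⟩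
      length (replicate (suc (toℕ i)) (AP n (G i) ℓ)) + length (replicate (h ∸ suc (toℕ i)) (AP n (G i) (suc ℓ)))
                                      ≡⟨ cong₂ _+_ (length-replicate (suc (toℕ i))) (length-replicate (h ∸ suc (toℕ i))) ⟩
      suc (toℕ i) + (h ∸ suc (toℕ i)) ≡⟨ m+[n∸m]≡n (toℕ<n i) ⟩
      h                               ∎
      where open ≡-Reasoning

  weight : Fin h → ℕ → ℕ
  weight i d = suc (toℕ i) * mult d (ΔS n (AP n (G i) ℓ)) + (h ∸ suc (toℕ i)) * mult d (ΔS n (AP n (G i) (suc ℓ)))

  mult-Δℱ : ∀ d → mult d Δℱ ≡ sum (map (λ i → weight i d) (allFin h))
  mult-Δℱ d = begin
    mult d (concatMap (ΔS n) (concatMap copies (allFin h)))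
      ≡⟨ cong (mult d) (concatMap-concatMap (ΔS n) copies (allFin h)) ⟩
    mult d (concatMap (concatMap (ΔS n) ∘ copies) (allFin h))
      ≡⟨ mult-concatMap d (concatMap (ΔS n) ∘ copies) (allFin h) ⟩
    sum (map (λ i → mult d (concatMap (ΔS n) (copies i))) (allFin h))
      ≡⟨ cong sum (map-cong mult-copies (allFin h)) ⟩
    sum (map (λ i → weight i d) (allFin h))
      ∎
    where
    open ≡-Reasoning
    mult-copies : ∀ i → mult d (concatMap (ΔS n) (copies i)) ≡ weight i d
    mult-copies i =
      trans (cong (mult d) (concatMap-++ (ΔS n) (replicate (suc (toℕ i)) _) _))
        (trans (mult-++ d (concatMap (ΔS n) (replicate (suc (toℕ i)) _)) _)
               (cong₂ _+_ (mult-concatMap-replicate d (ΔS n) (suc (toℕ i)) _)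
                          (mult-concatMap-replicate d (ΔS n) (h ∸ suc (toℕ i)) _)))

  mult-V-elsewhere : ∀ {i i′ c m} → i′ ≢ i → 1 ≤ c → c ≤ ℓ → m ≤ suc ℓ →
                     mult (V i c) (ΔS n (AP n (G i′) m)) ≡ 0
  mult-V-elsewhere {i} {i′} {c} i′≢i 1≤c c≤ℓ m≤1+ℓ = mult-∉ λ Vic∈ΔS →
    let c′ , 1≤c′ , c′≤ℓ , Vic≡Vi′c′ = APᵢ.∈-ΔS-AP⁻ i′ m≤1+ℓ Vic∈ΔS
    in i′≢i (sym (proj₁ (distinct i i′ c c′ 1≤c c≤ℓ 1≤c′ c′≤ℓ Vic≡Vi′c′)))

  -- The multiplicity of |c G i| in Δℱ.  Its base-h digits are h - 1 - i and ℓ - c, so μ is a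
  -- bijection from Fin h × [1, ℓ] onto [0, h ℓ).
  μ : Fin h → ℕ → ℕ
  μ i c = toℕ (opposite i) + (ℓ ∸ c) * h

  mult-V : ∀ i {c} → 1 ≤ c → c ≤ ℓ → mult (V i c) Δℱ ≡ μ i c
  mult-V i {c} 1≤c c≤ℓ = begin
    mult (V i c) Δℱ
      ≡⟨ mult-Δℱ (V i c) ⟩
    sum (map (λ i′ → weight i′ (V i c)) (allFin h))
      ≡⟨ sum-map-onlyAt (λ i′ → weight i′ (V i c)) (allFin⁺ h) (∈-allFin i) weight-other ⟩
    suc (toℕ i) * mult (V i c) (ΔS n (AP n (G i) ℓ)) + r * mult (V i c) (ΔS n (AP n (G i) (suc ℓ)))
      ≡⟨ cong₂ (λ a b → suc (toℕ i) * a + r * b) (APᵢ.mult-ΔS-AP i 1≤c c≤ℓ (n≤1+n ℓ)) (APᵢ.mult-ΔS-AP i 1≤c c≤ℓ ≤-refl) ⟩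
    suc (toℕ i) * (ℓ ∸ c) + r * (suc ℓ ∸ c)
      ≡⟨ cong (λ x → suc (toℕ i) * (ℓ ∸ c) + r * x) (+-∸-assoc 1 c≤ℓ) ⟩
    suc (toℕ i) * (ℓ ∸ c) + r * suc (ℓ ∸ c)
      ≡⟨ regroup (suc (toℕ i)) r (ℓ ∸ c) ⟩
    r + (suc (toℕ i) + r) * (ℓ ∸ c)
      ≡⟨ cong₂ (λ a b → a + b * (ℓ ∸ c)) (sym (opposite-prop i)) (m+[n∸m]≡n (toℕ<n i)) ⟩
    toℕ (opposite i) + h * (ℓ ∸ c)
      ≡⟨ cong (toℕ (opposite i) +_) (*-comm h (ℓ ∸ c)) ⟩
    μ i c
      ∎
    where
    open ≡-Reasoning
    r = h ∸ suc (toℕ i)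
    regroup : ∀ a b u → a * u + b * suc u ≡ b + (a + b) * u
    regroup = solve-∀
    weight-other : ∀ {i′} → i′ ≢ i → weight i′ (V i c) ≡ 0
    weight-other {i′} i′≢i
      rewrite mult-V-elsewhere i′≢i 1≤c c≤ℓ (n≤1+n ℓ) | mult-V-elsewhere i′≢i 1≤c c≤ℓ ≤-refl
            | *-zeroʳ (suc (toℕ i′)) | *-zeroʳ (h ∸ suc (toℕ i′)) = refl

  IsAbsMultiple : ℕ → Set
  IsAbsMultiple y = ∃₂ λ i c → 1 ≤ c × c ≤ ℓ × y ≡ V i c

  values-Δℱ : All IsAbsMultiple Δℱ
  values-Δℱ = All.concat⁺ (All.map⁺ (All.concat⁺ (All.map⁺ (All.tabulate⁺ values-copies))))
    where
    values-AP : ∀ i {m} → m ≤ suc ℓ → All IsAbsMultiple (ΔS n (AP n (G i) m))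
    values-AP i m≤1+ℓ = All.tabulate λ y∈ΔS →
      let c , 1≤c , c≤ℓ , y≡Vic = APᵢ.∈-ΔS-AP⁻ i m≤1+ℓ y∈ΔS in i , c , 1≤c , c≤ℓ , y≡Vic
    values-copies : ∀ i → All (All IsAbsMultiple ∘ ΔS n) (copies i)
    values-copies i = All.++⁺ (All.replicate⁺ (suc (toℕ i)) (values-AP i (n≤1+n ℓ)))
                              (All.replicate⁺ (h ∸ suc (toℕ i)) (values-AP i ≤-refl))

  μ<hℓ : ∀ i {c} → 1 ≤ c → c ≤ ℓ → μ i c < h * ℓ
  μ<hℓ i {c} 1≤c c≤ℓ = begin-strict
    toℕ (opposite i) + (ℓ ∸ c) * h   <⟨ +-monoˡ-< ((ℓ ∸ c) * h) (toℕ<n (opposite i)) ⟩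
    suc (ℓ ∸ c) * h                  ≤⟨ *-monoˡ-≤ h (∸-monoʳ-< 1≤c c≤ℓ) ⟩
    ℓ * h                            ≡⟨ *-comm ℓ h ⟩
    h * ℓ                            ∎
    where open ≤-Reasoning

  μ-injective : ∀ {i i′ c c′} → c ≤ ℓ → c′ ≤ ℓ → μ i c ≡ μ i′ c′ → i ≡ i′ × c ≡ c′
  μ-injective {i} {i′} c≤ℓ c′≤ℓ μ≡μ′
    with opp≡opp′ , u≡u′ ← mixed-radix-injective (toℕ<n (opposite i)) (toℕ<n (opposite i′)) μ≡μ′
    = i≡i′ , ∸-cancelˡ-≡ c≤ℓ c′≤ℓ u≡u′
    where
    i≡i′ : i ≡ i′
    i≡i′ = trans (sym (opposite-involutive i))
                 (trans (cong opposite (toℕ-injective opp≡opp′)) (opposite-involutive i′))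

  μ-surjective : ∀ {t} → t < h * ℓ → ∃₂ λ i c → 1 ≤ c × c ≤ ℓ × μ i c ≡ t
  μ-surjective {t} t<hℓ = opposite (t mod h) , ℓ ∸ t / h , m<n⇒0<n∸m q<ℓ , m∸n≤m ℓ (t / h) , μ≡t
    where
    open ≡-Reasoning
    q<ℓ : t / h < ℓ
    q<ℓ = m<n*o⇒m/o<n (subst (t <_) (*-comm h ℓ) t<hℓ)
    μ≡t : μ (opposite (t mod h)) (ℓ ∸ t / h) ≡ t
    μ≡t = begin
      toℕ (opposite (opposite (t mod h))) + (ℓ ∸ (ℓ ∸ t / h)) * h
        ≡⟨ cong₂ (λ a b → toℕ a + b * h) (opposite-involutive (t mod h)) (m∸[m∸n]≡n (<⇒≤ q<ℓ)) ⟩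
      toℕ (t mod h) + t / h * h
        ≡⟨ cong (_+ t / h * h) (toℕ-fromℕ< (m%n<n t h)) ⟩
      t % h + t / h * h
        ≡⟨ m≡m%n+[m/n]*n t h ⟨
      t ∎

  mult-injectiveOn : ∀ {y y′} → y ∈ Δℱ → y′ ∈ Δℱ → mult y Δℱ ≡ mult y′ Δℱ → y ≡ y′
  mult-injectiveOn y∈Δℱ y′∈Δℱ mult≡mult′
    with i  , c  , 1≤c  , c≤ℓ  , refl ← All.lookup values-Δℱ y∈Δℱ
    with i′ , c′ , 1≤c′ , c′≤ℓ , refl ← All.lookup values-Δℱ y′∈Δℱ
    with refl , refl ← μ-injective c≤ℓ c′≤ℓ (trans (sym (mult-V i 1≤c c≤ℓ)) (trans mult≡mult′ (mult-V i′ 1≤c′ c′≤ℓ)))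
    = refl

  mults : List ℕ
  mults = map (λ d → mult d Δℱ) (deduplicate _≟_ Δℱ)

  mults⊆ : ∀ {t} → t ∈ mults → t ∈ applyUpTo suc (h * ℓ ∸ 1)
  mults⊆ t∈mults
    with y , y∈dedup , refl ← ∈-map⁻ (λ d → mult d Δℱ) t∈mults
    with y∈Δℱ ← ∈-deduplicate⁻ _≟_ Δℱ y∈dedup
    with i , c , 1≤c , c≤ℓ , refl ← All.lookup values-Δℱ y∈Δℱ
    = ∈-applyUpTo-suc⁺ (h * ℓ) (mult-∈ y∈Δℱ) (subst (_< h * ℓ) (sym (mult-V i 1≤c c≤ℓ)) (μ<hℓ i 1≤c c≤ℓ))

  mults⊇ : ∀ {t} → t ∈ applyUpTo suc (h * ℓ ∸ 1) → t ∈ mults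
  mults⊇ t∈range
    with 1≤t , t<hℓ ← ∈-applyUpTo-suc⁻ (h * ℓ) t∈range
    with i , c , 1≤c , c≤ℓ , refl ← μ-surjective t<hℓ
    = subst (_∈ mults) (mult-V i 1≤c c≤ℓ) (∈-map⁺ (λ d → mult d Δℱ) (∈-deduplicate⁺ _≟_ Vic∈Δℱ))
    where
    Vic∈Δℱ : V i c ∈ Δℱ
    Vic∈Δℱ = mult-pos⇒∈ (subst (1 ≤_) (sym (mult-V i 1≤c c≤ℓ)) 1≤t)

  mults↭ : mults ↭ applyUpTo suc (h * ℓ ∸ 1)
  mults↭ = ∼bag⇒↭ (unique∧set⇒bag mults! (unique-applyUpTo-suc (h * ℓ ∸ 1)) (mk⇔ mults⊆ mults⊇))
    where
    mults! : Unique mults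
    mults! = unique-map-injectiveOn (λ d → mult d Δℱ)
               (λ y∈ y′∈ → mult-injectiveOn (∈-deduplicate⁻ _≟_ Δℱ y∈) (∈-deduplicate⁻ _≟_ Δℱ y′∈))
               (deduplicate-! Δℱ)

theorem4p1 : (h ℓ n : ℕ) → .{{_ : NonZero n}} → 3 ≤ ℓ → 2 ≤ h → (g : Fin h → Fin n)
    → (∀ (i i' : Fin h) (j j' : ℕ) → 1 ≤ j → j ≤ ℓ → 1 ≤ j' → j' ≤ ℓ
        → absn n (j * toℕ (g i)) ≡ absn n (j' * toℕ (g i')) → (i ≡ i') × (j ≡ j'))
    → ErdosDeep (ΔF n (family n h ℓ g))
      × (length (family n h ℓ g) ≡ h * h)
      × (length (ΔF n (family n h ℓ g)) ≡ (h * ℓ) C 2)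
theorem4p1 h ℓ n 3≤ℓ 2≤h g distinct = (h * ℓ , mults↭) , length-ℱ , length-deep (h * ℓ) Δℱ mults↭
  where open Family h ℓ n 3≤ℓ 2≤h g distinct
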